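{- For every graph $G$, $\chi(G)\leq \mathrm{smw}(G)$.
   Context: All graphs are finite, simple and undirected; $\chi(G)$ is the chromatic number. For vertices $u,v$ of a connected graph, $I(u,v)$ is the set of vertices on shortest $(u,v)$-paths; a vertex set $S$ is convex if $I(u,v)\subseteq S$ for all $u,v\in S$. A median graph is a connected graph $M$ with $|I(u,v)\cap I(v,w)\cap I(w,u)|=1$ for all vertices $u,v,w$. A median decomposition of $G$ is a pair $(M,\mathcal{X})$ with $M$ a median graph and $\mathcal{X}=(X_a)_{a\in V(M)}$ subsets of $V(G)$ such that (M1) every edge of $G$ has both ends in some $X_a$, and (M2) for every $v\in V(G)$, $X^{ -1}(v)=\{a: v\in X_a\}$ is non-empty and convex in $M$; its width is $\max_a|X_a|$. For an edge $ab$ of $M$ let $W_{ab}=\{v\in V(M): d(v,a)<d(v,b)\}$, $U_{ab}$ the set of vertices of $W_{ab}$ with a neighbour in $W_{ba}$, and $Z_{ab}=\bigcup_{x\in U_{ab}}X_x$. The decomposition is $\Theta$-smooth if for every edge $ab\in E(M)$ we have $|Z_{ab}\setminus Z_{ba}|=|Z_{ba}\setminus Z_{ab}|=1$ and, writing $Z_{ab}\setminus Z_{ba}=\{v_a\}$ and $Z_{ba}\setminus Z_{ab}=\{v_b\}$, the set $X^{ -1}(v_a)\cup X^{ -1}(v_b)$ is convex in $M$. The smooth-medianwidth $\mathrm{smw}(G)$ is the minimum width over all $\Theta$-smooth median decompositions of $G$. -}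

module Defs where

open import Data.Nat using (ℕ; zero; suc; _+_; _<_; _≤_)
open import Data.Fin using (Fin)
open import Data.Fin.Subset using (Subset; _∈_; ∣_∣)
open import Data.Bool using (Bool; true; false)
open import Data.Product using (Σ; _×_; _,_; ∃)
open import Data.Sum using (_⊎_)
open import Relation.Nullary using (¬_)
open import Relation.Binary.PropositionalEquality using (_≡_)

record Graph : Set where
  field
    n      : ℕ
    adj    : Fin n → Fin n → Bool
    sym    : ∀ u v → adj u v ≡ adj v u
    irrefl : ∀ u → adj u u ≡ false

open Graph public

E : (G : Graph) → Fin (n G) → Fin (n G) → Set
E G u v = adj G u v ≡ true

data Walk (G : Graph) : Fin (n G) → Fin (n G) → ℕ → Set where
  here : ∀ u → Walk G u u zero
  step : ∀ {u v w k} → E G u v → Walk G v w k → Walk G u w (suc k)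

Dist : (G : Graph) → Fin (n G) → Fin (n G) → ℕ → Set
Dist G u v k = Walk G u v k × (∀ j → j < k → ¬ Walk G u v j)

Connected : Graph → Set
Connected G = ∀ u v → ∃ λ k → Walk G u v k

Interval : (G : Graph) → Fin (n G) → Fin (n G) → Fin (n G) → Set
Interval G u v w =
  Σ ℕ λ a → Σ ℕ λ b → Σ ℕ λ c →
    Dist G u w a × Dist G w v b × Dist G u v c × (a + b ≡ c)

Convex : (G : Graph) → (Fin (n G) → Set) → Set
Convex G S = ∀ u v → S u → S v → ∀ w → Interval G u v w → S w

ExactlyOne : ∀ {A : Set} → (A → Set) → Set
ExactlyOne {A} S = Σ A λ x → S x × (∀ y → S y → y ≡ x)

IsMedian : Graph → Set
IsMedian M = Connected M ×
  (∀ u v w → ExactlyOne (λ x → Interval M u v x × Interval M v w x × Interval M w u x))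

record MedianDecomposition (G : Graph) : Set₁ where
  field
    M        : Graph
    isMedian : IsMedian M
    X        : Fin (n M) → Subset (n G)
    M1       : ∀ u v → E G u v → Σ (Fin (n M)) λ a → (u ∈ X a) × (v ∈ X a)
    M2-ne    : ∀ v → Σ (Fin (n M)) λ a → v ∈ X a
    M2-conv  : ∀ v → Convex M (λ a → v ∈ X a)

  Xinv : Fin (n G) → Fin (n M) → Set
  Xinv v a = v ∈ X a

  W : Fin (n M) → Fin (n M) → Fin (n M) → Set
  W a b v = Σ ℕ λ i → Σ ℕ λ j → Dist M v a i × Dist M v b j × i < j

  U : Fin (n M) → Fin (n M) → Fin (n M) → Set
  U a b x = W a b x × Σ (Fin (n M)) λ y → E M x y × W b a y

  Z : Fin (n M) → Fin (n M) → Fin (n G) → Set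
  Z a b v = Σ (Fin (n M)) λ x → U a b x × v ∈ X x

  ThetaSmooth : Set
  ThetaSmooth = ∀ a b → E M a b →
    Σ (Fin (n G)) λ va → Σ (Fin (n G)) λ vb →
      (Z a b va × ¬ Z b a va × (∀ w → Z a b w → ¬ Z b a w → w ≡ va)) ×
      (Z b a vb × ¬ Z a b vb × (∀ w → Z b a w → ¬ Z a b w → w ≡ vb)) ×
      Convex M (λ x → Xinv va x ⊎ Xinv vb x)

  WidthAtMost : ℕ → Set
  WidthAtMost k = ∀ a → ∣ X a ∣ ≤ k

open MedianDecomposition public

SmwAtMost : Graph → ℕ → Set₁
SmwAtMost G k = Σ (MedianDecomposition G) λ D → ThetaSmooth D × WidthAtMost D k

ChiAtMost : Graph → ℕ → Set
ChiAtMost G k = Σ (Fin (n G) → Fin k) λ c → ∀ u v → E G u v → ¬ c u ≡ c v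

module Submission where

-- Fix a root r of M. For an edge ab of M, Θ-smoothness and the convexity of the sets X⁻¹(v) give
-- X_a ∖ X_b ⊆ {v_a}, and v_a ∈ X_a forces v_b ∈ X_b; so fixing X_a ∩ X_b and sending v_a to v_b
-- is an injection X_a → X_b. Composing these along a shortest path to r maps each bag injectively
-- into X_r. The result does not depend on the shortest path: two of them leaving x through
-- different neighbours can be rerouted through a square of M (median property), and opposite
-- edges of a square have the same v_a and v_b, so the maps commute around it. By convexity of
-- X⁻¹(u), all bags containing u send u to the same element of X_r, which is the colour of u;
-- adjacent vertices share a bag, so they get distinct colours, at most |X_r| of them.

open import Defs hiding (sym)
open import Data.Nat using (ℕ; zero; suc; _+_; _<_; _≤_; z≤n; s≤s)
open import Data.Nat.Properties
open import Data.Fin using (Fin; zero; suc; inject≤)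
open import Data.Fin.Properties using (any?; ¬Fin0; inject≤-injective)
  renaming (_≟_ to _≟ᶠ_; suc-injective to fsuc-injective)
open import Data.Fin.Subset using (Subset; _∈_; _∉_; ∣_∣)
open import Data.Fin.Subset.Properties using (_∈?_)
open import Data.Vec using (_∷_; here; there)
open import Data.Bool using (true; false)
open import Data.Bool.Properties using () renaming (_≟_ to _≟ᵇ_)
open import Data.Empty using (⊥)
open import Data.Product using (Σ; _×_; _,_; proj₁; proj₂)
open import Data.Sum using (_⊎_; inj₁; inj₂)
open import Function using (_∘_)
open import Relation.Nullary using (¬_; Dec; yes; no; contradiction)
open import Relation.Nullary.Decidable using (map′; _×-dec_; recompute)
open import Relation.Unary using (Decidable)
open import Relation.Binary.PropositionalEquality

module Edges (G : Graph) where

  E-sym : ∀ {u v} → E G u v → E G v u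
  E-sym {u} {v} e = trans (Graph.sym G v u) e

  E-irrefl : ∀ {u v} → E G u v → u ≢ v
  E-irrefl {u} e refl with trans (sym e) (irrefl G u)
  ... | ()

least : {P : ℕ → Set} → Decidable P → ∀ k → P k → Σ ℕ λ m → P m × (∀ j → j < m → ¬ P j)
least P? zero p = 0 , p , λ _ ()
least P? (suc k) p with P? 0
... | yes p₀ = 0 , p₀ , λ _ ()
... | no ¬p₀ with least (λ j → P? (suc j)) k p
...   | m , pm , below = suc m , pm , λ { zero _ → ¬p₀ ; (suc j) (s≤s j<m) → below j j<m }

module Metric (G : Graph) (connected : Connected G) where

  open Edges G public

  V = Fin (n G)

  walk? : ∀ j u v → Dec (Walk G u v j)
  walk? zero u v = map′ (λ { refl → here u }) (λ { (here _) → refl }) (u ≟ᶠ v)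
  walk? (suc j) u v =
    map′ (λ (w , e , p) → step e p) (λ { (step e p) → _ , e , p })
         (any? λ w → (adj G u w ≟ᵇ true) ×-dec walk? j w v)

  _++ʷ_ : ∀ {u v w i j} → Walk G u v i → Walk G v w j → Walk G u w (i + j)
  here _ ++ʷ q = q
  step e p ++ʷ q = step e (p ++ʷ q)

  reverseʷ : ∀ {u v i} → Walk G u v i → Walk G v u i
  reverseʷ (here u) = here u
  reverseʷ {i = suc i} (step e p) = subst (Walk G _ _) (+-comm i 1) (reverseʷ p ++ʷ step (E-sym e) (here _))

  shortest : ∀ u v → Σ ℕ (Dist G u v)
  shortest u v = least (λ j → walk? j u v) (proj₁ (connected u v)) (proj₂ (connected u v))

  dist : V → V → ℕ
  dist u v = proj₁ (shortest u v)

  dist-Dist : ∀ u v → Dist G u v (dist u v)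
  dist-Dist u v = proj₂ (shortest u v)

  dist-walk : ∀ u v → Walk G u v (dist u v)
  dist-walk u v = proj₁ (dist-Dist u v)

  dist-minimal : ∀ {u v k} → Walk G u v k → dist u v ≤ k
  dist-minimal {u} {v} {k} p = ≮⇒≥ λ k<d → proj₂ (dist-Dist u v) k k<d p

  Dist⇒≡dist : ∀ {u v k} → Dist G u v k → k ≡ dist u v
  Dist⇒≡dist {u} {v} (p , below) =
    ≤-antisym (≮⇒≥ λ d<k → below (dist u v) d<k (dist-walk u v)) (dist-minimal p)

  geodesic : ∀ {u v k} → dist u v ≡ k → Walk G u v k
  geodesic {u} {v} eq = subst (Walk G u v) eq (dist-walk u v)

  dist-triangle : ∀ u v w → dist u w ≤ dist u v + dist v w
  dist-triangle u v w = dist-minimal (dist-walk u v ++ʷ dist-walk v w)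

  dist-sym : ∀ u v → dist u v ≡ dist v u
  dist-sym u v = ≤-antisym (dist-minimal (reverseʷ (dist-walk v u))) (dist-minimal (reverseʷ (dist-walk u v)))

  dist-refl : ∀ u → dist u u ≡ 0
  dist-refl u = n≤0⇒n≡0 (dist-minimal (here u))

  dist≡0⇒≡ : ∀ {u v} → dist u v ≡ 0 → u ≡ v
  dist≡0⇒≡ {u} {v} eq with geodesic {u} {v} eq
  ... | here _ = refl

  dist≡1⇒E : ∀ {u v} → dist u v ≡ 1 → E G u v
  dist≡1⇒E {u} {v} eq with geodesic {u} {v} eq
  ... | step e (here _) = e

  E⇒dist≡1 : ∀ {u v} → E G u v → dist u v ≡ 1
  E⇒dist≡1 {u} {v} e with dist u v in eq | dist-minimal (step e (here v))
  ... | zero        | _       = contradiction (dist≡0⇒≡ eq) (E-irrefl e)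
  ... | suc zero    | _       = refl
  ... | suc (suc _) | s≤s ()

  dist-step : ∀ {u v} → E G u v → ∀ w → dist w v ≤ suc (dist w u)
  dist-step {u} {v} e w =
    subst (dist w v ≤_) (trans (cong (dist w u +_) (E⇒dist≡1 e)) (+-comm (dist w u) 1)) (dist-triangle w u v)

  geodesic-tail : ∀ {u v w k} → E G u v → Walk G v w k → dist u w ≡ suc k → dist v w ≡ k
  geodesic-tail {u} {v} {w} e p eq =
    ≤-antisym (dist-minimal p)
              (≤-pred (subst₂ _≤_ eq (cong (_+ dist v w) (E⇒dist≡1 e)) (dist-triangle u v w)))

  Interval⇒dist : ∀ {u v w} → Interval G u v w → dist u w + dist w v ≡ dist u v
  Interval⇒dist (a , b , c , da , db , dc , eq) rewrite Dist⇒≡dist da | Dist⇒≡dist db | Dist⇒≡dist dc = eq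

  dist⇒Interval : ∀ {u v w} → dist u w + dist w v ≡ dist u v → Interval G u v w
  dist⇒Interval {u} {v} {w} eq = dist u w , dist w v , dist u v , dist-Dist u w , dist-Dist w v , dist-Dist u v , eq

m+n≡1-split : ∀ {a b} → a + b ≡ 1 → a ≡ 0 ⊎ b ≡ 0
m+n≡1-split {zero}  _  = inj₁ refl
m+n≡1-split {suc a} eq = inj₂ (m+n≡0⇒n≡0 a (suc-injective eq))

m+n≡2-split : ∀ {a b} → a + b ≡ 2 → a ≡ 0 ⊎ (a ≡ 1 × b ≡ 1) ⊎ b ≡ 0
m+n≡2-split {zero}        _  = inj₁ refl
m+n≡2-split {suc a} {b} eq with m+n≡1-split {a} {b} (suc-injective eq)
... | inj₁ refl = inj₂ (inj₁ (refl , suc-injective eq))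
... | inj₂ b≡0  = inj₂ (inj₂ b≡0)

module Median (M : Graph) (median : IsMedian M) where

  open Metric M (proj₁ median) public
  open ≡-Reasoning

  interval-of-edge : ∀ {a b w} → E M a b → Interval M a b w → w ≡ a ⊎ w ≡ b
  interval-of-edge {a} {b} {w} e i with m+n≡1-split (trans (Interval⇒dist i) (E⇒dist≡1 e))
  ... | inj₁ aw≡0 = inj₁ (sym (dist≡0⇒≡ aw≡0))
  ... | inj₂ wb≡0 = inj₂ (dist≡0⇒≡ wb≡0)

  adjacent-levels : ∀ {a b} → E M a b → ∀ v → dist v b ≡ suc (dist v a) ⊎ dist v a ≡ suc (dist v b)
  adjacent-levels {a} {b} e v with proj₂ median a b v
  ... | m , (abm , bvm , vam) , _ with interval-of-edge e abm
  ...   | inj₁ refl = inj₁ (begin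
            dist v b              ≡⟨ dist-sym v b ⟩
            dist b v              ≡⟨ Interval⇒dist bvm ⟨
            dist b a + dist a v   ≡⟨ cong₂ _+_ (E⇒dist≡1 (E-sym e)) (dist-sym a v) ⟩
            suc (dist v a)        ∎)
  ...   | inj₂ refl = inj₂ (begin
            dist v a              ≡⟨ Interval⇒dist vam ⟨
            dist v b + dist b a   ≡⟨ cong (dist v b +_) (E⇒dist≡1 (E-sym e)) ⟩
            dist v b + 1          ≡⟨ +-comm (dist v b) 1 ⟩
            suc (dist v b)        ∎)

  adjacent-dist-≢ : ∀ {a b} → E M a b → ∀ v → dist v a ≢ dist v b
  adjacent-dist-≢ e v va≡vb with adjacent-levels e v
  ... | inj₁ vb≡1+va = 1+n≢n (trans (sym vb≡1+va) (sym va≡vb))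
  ... | inj₂ va≡1+vb = 1+n≢n (trans (sym va≡1+vb) va≡vb)

  common-neighbour-dist : ∀ {x p q} → E M x p → E M x q → p ≢ q → dist p q ≡ 2
  common-neighbour-dist {x} {p} {q} xp xq p≢q with dist p q in eq | dist-triangle p x q
  ... | 0 | _ = contradiction (dist≡0⇒≡ eq) p≢q
  ... | 1 | _ = contradiction (trans (E⇒dist≡1 xp) (sym (E⇒dist≡1 xq))) (adjacent-dist-≢ (dist≡1⇒E eq) x)
  common-neighbour-dist {x} {p} {q} xp xq p≢q | 2 | _ = refl
  common-neighbour-dist {x} {p} {q} xp xq p≢q | suc (suc (suc _)) | le =
    contradiction (≤-trans le (≤-reflexive (cong₂ _+_ (trans (dist-sym p x) (E⇒dist≡1 xp))
                                                       (E⇒dist≡1 xq))))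
                  λ { (s≤s (s≤s ())) }

  record Square (x p z q : V) : Set where
    field
      xp  : E M x p
      pz  : E M p z
      zq  : E M z q
      qx  : E M q x
      p≢q : p ≢ q
      x≢z : x ≢ z

  rotate : ∀ {x p z q} → Square x p z q → Square p z q x
  rotate s = record { xp = pz ; pz = zq ; zq = qx ; qx = xp ; p≢q = x≢z ∘ sym ; x≢z = p≢q }
    where open Square s

  reverse : ∀ {x p z q} → Square x p z q → Square x q z p
  reverse s = record { xp = E-sym qx ; pz = E-sym zq ; zq = E-sym pz ; qx = E-sym xp
                     ; p≢q = p≢q ∘ sym ; x≢z = x≢z }
    where open Square s

  -- Otherwise x and z would both be medians of p, q, v.
  square-cut : ∀ {x p z q} → Square x p z q → ∀ v → dist v x < dist v p → dist v q < dist v z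
  square-cut {x} {p} {z} {q} s v x<p with adjacent-levels (Square.zq s) v
  ... | inj₂ z≡1+q = ≤-reflexive (sym z≡1+q)
  ... | inj₁ q≡1+z = contradiction (trans (unique x (candidate x (E-sym xp) (E-sym qx) refl))
                                          (sym (unique z (candidate z pz zq z≡D)))) x≢z
    where
    open Square s
    D = dist v x
    unique = proj₂ (proj₂ (proj₂ median p q v))
    p≡1+D : dist v p ≡ suc D
    p≡1+D with adjacent-levels xp v
    ... | inj₁ p≡1+x = p≡1+x
    ... | inj₂ x≡1+p = contradiction (≤-reflexive (sym x≡1+p)) (<-asym x<p)
    z≡D : dist v z ≡ D
    z≡D = ≤-antisym (≤-pred (subst (_≤ suc D) q≡1+z (dist-step (E-sym qx) v)))
                    (≤-pred (subst (_≤ suc (dist v z)) p≡1+D (dist-step (E-sym pz) v)))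
    q≡1+D : dist v q ≡ suc D
    q≡1+D = trans q≡1+z (cong suc z≡D)
    candidate : ∀ w → E M p w → E M w q → dist v w ≡ D →
                Interval M p q w × Interval M q v w × Interval M v p w
    candidate w pw wq vw≡D =
        dist⇒Interval (trans (cong₂ _+_ (E⇒dist≡1 pw) (E⇒dist≡1 wq))
                             (sym (common-neighbour-dist xp (E-sym qx) p≢q)))
      , dist⇒Interval (begin
          dist q w + dist w v ≡⟨ cong₂ _+_ (E⇒dist≡1 (E-sym wq)) (trans (dist-sym w v) vw≡D) ⟩
          suc D               ≡⟨ q≡1+D ⟨
          dist v q            ≡⟨ dist-sym v q ⟩
          dist q v            ∎)
      , dist⇒Interval (begin
          dist v w + dist w p ≡⟨ cong₂ _+_ vw≡D (E⇒dist≡1 (E-sym pw)) ⟩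
          D + 1               ≡⟨ +-comm D 1 ⟩
          suc D               ≡⟨ p≡1+D ⟨
          dist v p            ∎)

  square-completion : ∀ {x p q r m} → E M x p → E M x q → p ≢ q → dist p r ≡ suc m → dist q r ≡ suc m →
                      Σ V λ z → E M p z × E M q z × dist z r ≡ m
  square-completion {x} {p} {q} {r} {m} xp xq p≢q pr qr with proj₂ median p q r
  ... | c , (pqc , qrc , rpc) , _ with m+n≡2-split (trans (Interval⇒dist pqc) (common-neighbour-dist xp xq p≢q))
  ...   | inj₁ pc≡0 with dist≡0⇒≡ pc≡0
  ...     | refl = contradiction (begin
              suc m                   ≡⟨ qr ⟨
              dist q r                ≡⟨ Interval⇒dist qrc ⟨
              dist q p + dist p r     ≡⟨ cong₂ _+_ (trans (dist-sym q p) (common-neighbour-dist xp xq p≢q)) pr ⟩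
              2 + suc m               ∎) (m≢1+n+m (suc m) {1})
  square-completion {x} {p} {q} {r} {m} xp xq p≢q pr qr
      | c , (pqc , qrc , rpc) , _ | inj₂ (inj₂ cq≡0) with dist≡0⇒≡ cq≡0
  ...     | refl = contradiction (begin
              suc m + 2               ≡⟨ cong₂ _+_ (trans (dist-sym r q) qr) (common-neighbour-dist xq xp (p≢q ∘ sym)) ⟨
              dist r q + dist q p     ≡⟨ Interval⇒dist rpc ⟩
              dist r p                ≡⟨ dist-sym r p ⟩
              dist p r                ≡⟨ pr ⟩
              suc m                   ∎) (m+1+n≢m (suc m) {1})
  square-completion {x} {p} {q} {r} {m} xp xq p≢q pr qr
      | c , (pqc , qrc , rpc) , _ | inj₂ (inj₁ (pc≡1 , cq≡1)) =
    c , dist≡1⇒E pc≡1 , E-sym (dist≡1⇒E cq≡1) ,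
    suc-injective (trans (sym (cong (_+ dist c r) (trans (dist-sym q c) cq≡1))) (trans (Interval⇒dist qrc) qr))

module Smooth {G : Graph} (D : MedianDecomposition G) (smooth : ThetaSmooth D) where

  open Median (M D) (isMedian D)
  open ≡-Reasoning

  W⇒< : ∀ {a b v} → W D a b v → dist v a < dist v b
  W⇒< (i , j , vi , vj , i<j) = subst₂ _<_ (Dist⇒≡dist vi) (Dist⇒≡dist vj) i<j

  <⇒W : ∀ {a b v} → dist v a < dist v b → W D a b v
  <⇒W {a} {b} {v} lt = dist v a , dist v b , dist-Dist v a , dist-Dist v b , lt

  U-source : ∀ {a b} → E (M D) a b → U D a b a
  U-source {a} {b} e = <⇒W (closer e) , b , e , <⇒W (closer (E-sym e))
    where
    closer : ∀ {a b} → E (M D) a b → dist a a < dist a b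
    closer {a} e = subst₂ _<_ (sym (dist-refl a)) (sym (E⇒dist≡1 e)) (s≤s z≤n)

  W-interval : ∀ {a b y} → E (M D) a b → W D b a y → Interval (M D) y a b
  W-interval {a} {b} {y} e y∈W = dist⇒Interval (begin
    dist y b + dist b a   ≡⟨ cong (dist y b +_) (E⇒dist≡1 (E-sym e)) ⟩
    dist y b + 1          ≡⟨ +-comm (dist y b) 1 ⟩
    suc (dist y b)        ≡⟨ ≤-antisym (W⇒< y∈W) (dist-step (E-sym e) y) ⟩
    dist y a              ∎)

  W-square : ∀ {x p z q v} → Square x p z q → W D x p v → W D q z v
  W-square s v∈W = <⇒W (square-cut s _ (W⇒< v∈W))

  Z-mono : ∀ {a b a′ b′} → (∀ {v} → W D a b v → W D a′ b′ v) → (∀ {v} → W D b a v → W D b′ a′ v) →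
           ∀ {w} → Z D a b w → Z D a′ b′ w
  Z-mono f g (y , (y∈W , y′ , e , y′∈W) , w∈X) = y , (f y∈W , y′ , e , g y′∈W) , w∈X

  -- `leaving e` is the vertex v_a of Z_ab ∖ Z_ba, and v_b is `leaving (E-sym e)`.
  -- Recomputing the edge proof lets `leaving` and `transfer` take it irrelevantly, so that
  -- reversing an edge twice, or using another proof of the same edge, changes nothing.
  edge : ∀ {a b} → .(E (M D) a b) → E (M D) a b
  edge {a} {b} e = recompute (adj (M D) a b ≟ᵇ true) e

  leaving : ∀ {a b} → .(E (M D) a b) → Fin (n G)
  leaving {a} {b} e = proj₁ (smooth a b (edge e))

  leaving-Z : ∀ {a b} (e : E (M D) a b) → Z D a b (leaving e)
  leaving-Z {a} {b} e = proj₁ (proj₁ (proj₂ (proj₂ (smooth a b (edge e)))))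

  leaving-¬Z : ∀ {a b} (e : E (M D) a b) → ¬ Z D b a (leaving e)
  leaving-¬Z {a} {b} e = proj₁ (proj₂ (proj₁ (proj₂ (proj₂ (smooth a b (edge e))))))

  leaving-unique : ∀ {a b} (e : E (M D) a b) {w} → Z D a b w → ¬ Z D b a w → w ≡ leaving e
  leaving-unique {a} {b} e {w} = proj₂ (proj₂ (proj₁ (proj₂ (proj₂ (smooth a b (edge e)))))) w

  leaving-convex : ∀ {a b} (e : E (M D) a b) →
                   Convex (M D) (λ x → leaving e ∈ X D x ⊎ leaving (E-sym e) ∈ X D x)
  leaving-convex {a} {b} e =
    subst (λ v → Convex (M D) (λ x → leaving e ∈ X D x ⊎ v ∈ X D x))
          (leaving-unique (E-sym e) vb∈Z vb∉Z) convex
    where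
    entering = proj₂ (proj₂ (proj₂ (smooth a b (edge e))))
    vb∈Z = proj₁ (proj₁ entering)
    vb∉Z = proj₁ (proj₂ (proj₁ entering))
    convex = proj₂ entering

  ∈⇒Z : ∀ {a b w} → E (M D) a b → w ∈ X D a → Z D a b w
  ∈⇒Z {a} e w∈a = a , U-source e , w∈a

  Z⇒∈ : ∀ {a b w} → E (M D) a b → w ∈ X D a → Z D b a w → w ∈ X D b
  Z⇒∈ {a} {b} {w} e w∈a (y , (y∈W , _) , w∈y) = M2-conv D w y a w∈y w∈a b (W-interval e y∈W)

  left-behind : ∀ {a b w} (e : E (M D) a b) → w ∈ X D a → w ∉ X D b → w ≡ leaving e
  left-behind e w∈a w∉b = leaving-unique e (∈⇒Z e w∈a) (w∉b ∘ Z⇒∈ e w∈a)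

  leaving-∉ : ∀ {a b} (e : E (M D) a b) → leaving e ∉ X D b
  leaving-∉ e = leaving-¬Z e ∘ ∈⇒Z (E-sym e)

  leaving-∈⇒entering-∈ : ∀ {a b} (e : E (M D) a b) → leaving e ∈ X D a → leaving (E-sym e) ∈ X D b
  leaving-∈⇒entering-∈ {a} {b} e ℓ∈a with leaving-Z (E-sym e)
  ... | y , (y∈W , _) , ℓ′∈y with leaving-convex e y a (inj₂ ℓ′∈y) (inj₁ ℓ∈a) b (W-interval e y∈W)
  ...   | inj₁ ℓ∈b  = contradiction ℓ∈b (leaving-∉ e)
  ...   | inj₂ ℓ′∈b = ℓ′∈b

  -- Opposite edges of a square induce the same cut, hence the same sets Z.
  leaving-square : ∀ {x p z q} (s : Square x p z q) → leaving (Square.xp s) ≡ leaving (E-sym (Square.zq s))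
  leaving-square s = sym (leaving-unique xp
    (Z-mono (W-square (rotate (reverse s))) (W-square (rotate (rotate s))) (leaving-Z (E-sym zq)))
    (leaving-¬Z (E-sym zq) ∘ Z-mono (W-square (reverse (rotate s))) (W-square s)))
    where open Square s

  transfer : ∀ {a b} → .(E (M D) a b) → Fin (n G) → Fin (n G)
  transfer {b = b} e w with w ∈? X D b
  ... | yes _ = w
  ... | no _  = leaving (E-sym e)

  transfer-id : ∀ {a b w} (e : E (M D) a b) → w ∈ X D b → transfer e w ≡ w
  transfer-id {b = b} {w} e w∈b with w ∈? X D b
  ... | yes _   = refl
  ... | no w∉b = contradiction w∈b w∉b

  transfer-∉ : ∀ {a b w} (e : E (M D) a b) → w ∉ X D b → transfer e w ≡ leaving (E-sym e)
  transfer-∉ {b = b} {w} e w∉b with w ∈? X D b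
  ... | yes w∈b = contradiction w∈b w∉b
  ... | no _    = refl

  transfer-∈ : ∀ {a b w} (e : E (M D) a b) → w ∈ X D a → transfer e w ∈ X D b
  transfer-∈ {b = b} {w} e w∈a with w ∈? X D b
  ... | yes w∈b = w∈b
  ... | no w∉b  = leaving-∈⇒entering-∈ e (subst (_∈ X D _) (left-behind e w∈a w∉b) w∈a)

  transfer-injective : ∀ {a b w w′} (e : E (M D) a b) → w ∈ X D a → w′ ∈ X D a →
                       transfer e w ≡ transfer e w′ → w ≡ w′
  transfer-injective {b = b} {w} {w′} e w∈a w′∈a eq with w ∈? X D b | w′ ∈? X D b
  ... | yes _   | yes _    = eq
  ... | yes _   | no _     = contradiction (subst (_∈ X D _) eq w∈a) (leaving-∉ (E-sym e))
  ... | no _    | yes _    = contradiction (subst (_∈ X D _) (sym eq) w′∈a) (leaving-∉ (E-sym e))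
  ... | no w∉b  | no w′∉b  = trans (left-behind e w∈a w∉b) (sym (left-behind e w′∈a w′∉b))

  transfer-square-one-side : ∀ {x p z q w} (s : Square x p z q) → let open Square s in
    w ∈ X D x → w ∈ X D p → w ∉ X D q →
    transfer pz (transfer xp w) ≡ transfer (E-sym zq) (transfer (E-sym qx) w)
  transfer-square-one-side {x} {p} {z} {q} {w} s w∈x w∈p w∉q = begin
    transfer pz (transfer xp w)              ≡⟨ cong (transfer pz) (transfer-id xp w∈p) ⟩
    transfer pz w                            ≡⟨ transfer-∉ pz (subst (_∉ X D z) (sym w≡ℓ) (leaving-∉ pz)) ⟩
    leaving (E-sym pz)                       ≡⟨ transfer-id (E-sym zq) entering∈z ⟨
    transfer (E-sym zq) (leaving (E-sym pz)) ≡⟨ cong (transfer (E-sym zq)) qx∥zp ⟨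
    transfer (E-sym zq) (leaving qx)         ≡⟨ cong (transfer (E-sym zq)) (transfer-∉ (E-sym qx) w∉q) ⟨
    transfer (E-sym zq) (transfer (E-sym qx) w) ∎
    where
    open Square s
    w≡ℓ : w ≡ leaving pz
    w≡ℓ = trans (left-behind (E-sym qx) w∈x w∉q) (leaving-square (reverse s))
    entering∈z : leaving (E-sym pz) ∈ X D z
    entering∈z = leaving-∈⇒entering-∈ pz (subst (_∈ X D p) w≡ℓ w∈p)
    qx∥zp : leaving qx ≡ leaving (E-sym pz)
    qx∥zp = leaving-square (rotate (rotate (rotate s)))

  transfer-square : ∀ {x p z q w} (s : Square x p z q) → let open Square s in
    w ∈ X D x → transfer pz (transfer xp w) ≡ transfer (E-sym zq) (transfer (E-sym qx) w)
  transfer-square {x} {p} {z} {q} {w} s w∈x = by-cases (w ∈? X D p) (w ∈? X D q)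
    where
    open Square s

    w∈p∩q⇒∈z : w ∈ X D p → w ∈ X D q → w ∈ X D z
    w∈p∩q⇒∈z w∈p w∈q with w ∈? X D z
    ... | yes w∈z = w∈z
    ... | no w∉z  = contradiction
      (subst (_∈ X D p) (trans (left-behind (E-sym zq) w∈q w∉z) (sym (leaving-square s))) w∈p) (leaving-∉ xp)

    w∉p∪q : w ∉ X D p → w ∉ X D q → ⊥
    w∉p∪q w∉p w∉q with leaving (E-sym xp) ∈? X D z
    ... | yes ℓ∈z = w∉q (subst (_∈ X D q) (trans (sym (leaving-square s)) (sym w≡xp))
                      (leaving-∈⇒entering-∈ zq (subst (_∈ X D z) (leaving-square (reverse (rotate s))) ℓ∈z)))
      where w≡xp = left-behind xp w∈x w∉p
    ... | no ℓ∉z  = leaving-∉ (E-sym xp) (subst (_∈ X D x) w≡ℓ w∈x)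
      where
      w≡xp = left-behind xp w∈x w∉p
      ℓ∈p = leaving-∈⇒entering-∈ xp (subst (_∈ X D x) w≡xp w∈x)
      w≡ℓ = trans (left-behind (E-sym qx) w∈x w∉q)
                  (trans (leaving-square (reverse s)) (sym (left-behind pz ℓ∈p ℓ∉z)))

    by-cases : Dec (w ∈ X D p) → Dec (w ∈ X D q) →
               transfer pz (transfer xp w) ≡ transfer (E-sym zq) (transfer (E-sym qx) w)
    by-cases (yes w∈p) (no w∉q)  = transfer-square-one-side s w∈x w∈p w∉q
    by-cases (no w∉p)  (yes w∈q) = sym (transfer-square-one-side (reverse s) w∈x w∈q w∉p)
    by-cases (no w∉p)  (no w∉q)  = contradiction w∉q (w∉p∪q w∉p)
    by-cases (yes w∈p) (yes w∈q) = begin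
      transfer pz (transfer xp w)                  ≡⟨ cong (transfer pz) (transfer-id xp w∈p) ⟩
      transfer pz w                                ≡⟨ transfer-id pz w∈z ⟩
      w                                            ≡⟨ transfer-id (E-sym zq) w∈z ⟨
      transfer (E-sym zq) w                        ≡⟨ cong (transfer (E-sym zq)) (transfer-id (E-sym qx) w∈q) ⟨
      transfer (E-sym zq) (transfer (E-sym qx) w)  ∎
      where w∈z = w∈p∩q⇒∈z w∈p w∈q

  transport : ∀ {x y k} → Walk (M D) x y k → Fin (n G) → Fin (n G)
  transport (here _)   w = w
  transport (step e p) w = transport p (transfer e w)

  transport-∈ : ∀ {x y k w} (p : Walk (M D) x y k) → w ∈ X D x → transport p w ∈ X D y
  transport-∈ (here _)   w∈x = w∈x
  transport-∈ (step e p) w∈x = transport-∈ p (transfer-∈ e w∈x)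

  transport-injective : ∀ {x y k w w′} (p : Walk (M D) x y k) → w ∈ X D x → w′ ∈ X D x →
                        transport p w ≡ transport p w′ → w ≡ w′
  transport-injective (here _)   _   _    eq = eq
  transport-injective (step e p) w∈x w′∈x eq =
    transfer-injective e w∈x w′∈x (transport-injective p (transfer-∈ e w∈x) (transfer-∈ e w′∈x) eq)

  bag : Fin (n G) → V
  bag u = proj₁ (M2-ne D u)

  bag-∈ : ∀ u → u ∈ X D (bag u)
  bag-∈ u = proj₂ (M2-ne D u)

  module Rooted (r : V) where

    GeodesicsAgree : ℕ → Set
    GeodesicsAgree m = ∀ {x w} (p q : Walk (M D) x r m) → dist x r ≡ m → w ∈ X D x →
                       transport p w ≡ transport q w

    geodesics-agree-around-square : ∀ {m} → GeodesicsAgree (suc m) →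
      ∀ {x a b w} (xa : E (M D) x a) (xb : E (M D) x b)
      (p : Walk (M D) a r (suc m)) (q : Walk (M D) b r (suc m)) →
      a ≢ b → dist x r ≡ suc (suc m) → w ∈ X D x → transport (step xa p) w ≡ transport (step xb q) w
    geodesics-agree-around-square {m} agree {x} {a} {b} {w} xa xb p q a≢b xr w∈x = begin
      transport p (transfer xa w)                ≡⟨ agree p (step az g) ar (transfer-∈ xa w∈x) ⟩
      transport g (transfer az (transfer xa w))  ≡⟨ cong (transport g) (transfer-square square w∈x) ⟩
      transport g (transfer bz (transfer xb w))  ≡⟨ agree q (step bz g) br (transfer-∈ xb w∈x) ⟨
      transport q (transfer xb w)                ∎
      where
      ar = geodesic-tail xa p xr
      br = geodesic-tail xb q xr
      completion = square-completion xa xb a≢b ar br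
      z = proj₁ completion
      az = proj₁ (proj₂ completion)
      bz = proj₁ (proj₂ (proj₂ completion))
      zr = proj₂ (proj₂ (proj₂ completion))
      g = geodesic zr
      x≢z : x ≢ z
      x≢z x≡z = m≢1+n+m m {1} (trans (sym zr) (subst (λ y → dist y r ≡ suc (suc m)) x≡z xr))
      square : Square x a z b
      square = record { xp = xa ; pz = az ; zq = E-sym bz ; qx = E-sym xb ; p≢q = a≢b ; x≢z = x≢z }

    geodesics-agree-step : ∀ {m} → GeodesicsAgree (suc m) → GeodesicsAgree (suc (suc m))
    geodesics-agree-step agree (step {v = a} xa p) (step {v = b} xb q) xr w∈x with a ≟ᶠ b
    ... | yes refl = agree p q (geodesic-tail xa p xr) (transfer-∈ xa w∈x)
    ... | no a≢b   = geodesics-agree-around-square agree xa xb p q a≢b xr w∈x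

    geodesics-agree : ∀ m → GeodesicsAgree m
    geodesics-agree zero          (here _)           (here _)           _ _ = refl
    geodesics-agree (suc zero)    (step _ (here _))  (step _ (here _))  _ _ = refl
    geodesics-agree (suc (suc m)) = geodesics-agree-step (geodesics-agree (suc m))

    to-root : V → Fin (n G) → Fin (n G)
    to-root x = transport (dist-walk x r)

    transport-geodesic : ∀ {x m w} (p : Walk (M D) x r m) → dist x r ≡ m → w ∈ X D x →
                         transport p w ≡ to-root x w
    transport-geodesic p refl w∈x = geodesics-agree _ p (dist-walk _ r) refl w∈x

    to-root-step : ∀ {x y u} → E (M D) y x → dist y r ≡ suc (dist x r) → u ∈ X D x → u ∈ X D y →
                      to-root y u ≡ to-root x u
    to-root-step {x} {y} {u} yx yr u∈x u∈y = begin
      to-root y u                          ≡⟨ transport-geodesic (step yx (dist-walk x r)) yr u∈y ⟨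
      transport (dist-walk x r) (transfer yx u) ≡⟨ cong (transport (dist-walk x r)) (transfer-id yx u∈x) ⟩
      to-root x u                          ∎

    root-dist-sym : ∀ {x y} → dist r y ≡ suc (dist r x) → dist y r ≡ suc (dist x r)
    root-dist-sym {x} {y} eq = trans (dist-sym y r) (trans eq (cong suc (dist-sym r x)))

    to-root-edge : ∀ {x y u} → E (M D) x y → u ∈ X D x → u ∈ X D y → to-root x u ≡ to-root y u
    to-root-edge {x} {y} xy u∈x u∈y with adjacent-levels xy r
    ... | inj₁ ry≡1+rx = sym (to-root-step (E-sym xy) (root-dist-sym ry≡1+rx) u∈x u∈y)
    ... | inj₂ rx≡1+ry = to-root-step xy (root-dist-sym rx≡1+ry) u∈y u∈x

    to-root-along : ∀ {x y k u} (p : Walk (M D) x y k) → dist x y ≡ k → u ∈ X D x → u ∈ X D y →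
                       to-root x u ≡ to-root y u
    to-root-along (here _) _ _ _ = refl
    to-root-along {x} {y} {u = u} (step {v = a} xa p) xy u∈x u∈y =
      trans (to-root-edge xa u∈x u∈a) (to-root-along p ay u∈a u∈y)
      where
      ay = geodesic-tail xa p xy
      u∈a = M2-conv D u x y u∈x u∈y a (dist⇒Interval (trans (cong₂ _+_ (E⇒dist≡1 xa) ay) (sym xy)))

    to-root-agrees : ∀ {x y u} → u ∈ X D x → u ∈ X D y → to-root x u ≡ to-root y u
    to-root-agrees {x} {y} = to-root-along (dist-walk x y) refl

    label : Fin (n G) → Fin (n G)
    label u = to-root (bag u) u

    label-∈ : ∀ u → label u ∈ X D r
    label-∈ u = transport-∈ (dist-walk (bag u) r) (bag-∈ u)

    label-proper : ∀ {u v} → E G u v → label u ≢ label v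
    label-proper {u} {v} uv eq with M1 D u v uv
    ... | a , u∈a , v∈a = Edges.E-irrefl G uv (transport-injective (dist-walk a r) u∈a v∈a (begin
      to-root a u     ≡⟨ to-root-agrees (bag-∈ u) u∈a ⟨
      label u            ≡⟨ eq ⟩
      label v            ≡⟨ to-root-agrees (bag-∈ v) v∈a ⟩
      to-root a v     ∎))

rank : ∀ {m} (S : Subset m) {w} → w ∈ S → Fin ∣ S ∣
rank (true ∷ S)  here        = zero
rank (true ∷ S)  (there w∈S) = suc (rank S w∈S)
rank (false ∷ S) (there w∈S) = rank S w∈S

rank-injective : ∀ {m} (S : Subset m) {w w′} (w∈S : w ∈ S) (w′∈S : w′ ∈ S) →
                 rank S w∈S ≡ rank S w′∈S → w ≡ w′
rank-injective (true ∷ S)  here        here         _  = refl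
rank-injective (true ∷ S)  (there w∈S) (there w′∈S) eq =
  cong suc (rank-injective S w∈S w′∈S (fsuc-injective eq))
rank-injective (false ∷ S) (there w∈S) (there w′∈S) eq =
  cong suc (rank-injective S w∈S w′∈S eq)

colouring-from-labelling : (G : Graph) {m k : ℕ} (S : Subset m) → ∣ S ∣ ≤ k →
                           (ℓ : Fin (n G) → Fin m) (ℓ∈S : ∀ u → ℓ u ∈ S) →
                           (∀ {u v} → E G u v → ℓ u ≢ ℓ v) → ChiAtMost G k
colouring-from-labelling G S ∣S∣≤k ℓ ℓ∈S proper =
  (λ u → inject≤ (rank S (ℓ∈S u)) ∣S∣≤k) ,
  λ u v uv eq → proper uv (rank-injective S (ℓ∈S u) (ℓ∈S v) (inject≤-injective ∣S∣≤k ∣S∣≤k _ _ eq))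

inhabited-or-empty : ∀ m → Fin m ⊎ ¬ Fin m
inhabited-or-empty zero    = inj₂ ¬Fin0
inhabited-or-empty (suc m) = inj₁ zero

colouring-from-vertex : (G : Graph) {k : ℕ} → (Fin (n G) → ChiAtMost G k) → ChiAtMost G k
colouring-from-vertex G f with inhabited-or-empty (n G)
... | inj₁ u     = f u
... | inj₂ empty = (λ u → contradiction u empty) , (λ u → contradiction u empty)

lemma4p2 : (G : Graph) (k : ℕ) → SmwAtMost G k → ChiAtMost G k
lemma4p2 G k (D , smooth , width) = colouring-from-vertex G λ u →
  let open Smooth D smooth
      open Rooted (bag u)
  in colouring-from-labelling G (X D (bag u)) (width (bag u)) label label-∈ label-proper
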